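{- Let $(A,\mapsto)$ be a PARS, let $a\in A$ and let $T\in\mathcal{T}(a)$ be a (finite) computation tree with root $a$. Then $[(1,a)] \to_P^{*} \mathrm{supp}(T)$, where $\to_P^{*}$ is the reflexive-transitive closure of $\to_P$.
   Context: For a set $A$, $\mathrm{Dist}(A)$ is the set of finite lists of pairs $(p,a)$ with $p\in\mathbb{R}^+$ (positive reals) and $a\in A$; $[\,]$ is the empty list, $::$ is list cons, $++$ is concatenation, and $[(p_1,a_1),\dots,(p_n,a_n)]$ is written $[(p_i,a_i)]_i$. The weight of a list is the sum of its $p_i$; $\mathrm{Dist}_1(A)$ is the set of lists of weight $1$. For $\alpha\in\mathbb{R}^+$, $\alpha[(p_i,a_i)]_i=[(\alpha p_i,a_i)]_i$. A probabilistic abstract rewriting system (PARS) is a pair $(A,\mapsto)$ with $\mapsto\subseteq A\times\mathrm{Dist}_1(A)$. The set $\mathcal{T}(a)$ of (finite) computation trees with root $a$ is defined inductively: $a\in\mathcal{T}(a)$; and if $a\mapsto[(p_1,a_1),\dots,(p_n,a_n)]$ and $t_i\in\mathcal{T}(a_i)$ for each $i$, then $[a;(p_1,t_1);\dots;(p_n,t_n)]\in\mathcal{T}(a)$. The support is defined by $\mathrm{supp}(a)=[(1,a)]$ and $\mathrm{supp}([a;(p_1,t_1);\dots;(p_n,t_n)])=p_1\mathrm{supp}(t_1)++\cdots++p_n\mathrm{supp}(t_n)$. Parallel evolution $\to_P\subseteq\mathrm{Dist}(A)\times\mathrm{Dist}(A)$ is defined inductively by: $[\,]\to_P[\,]$;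 if $ds\to_P ds'$ then $(p,a)::ds\to_P(p,a)::ds'$; if $a\mapsto E$ and $ds\to_P ds'$ then $(p,a)::ds\to_P pE++ds'$. -}

module Defs where

open import Data.List using (List; []; _∷_; _++_; map; foldr)
open import Data.List.Relation.Unary.All using (All; []; _∷_)
open import Data.Product using (_×_; _,_; proj₁; proj₂)
open import Relation.Binary.PropositionalEquality using (_≡_)
open import Relation.Binary.Construct.Closure.ReflexiveTransitive using (Star)
open import Algebra.Structures using (IsCommutativeSemigroup; IsCommutativeMonoid)
open import Algebra.Definitions using (_DistributesOver_)

-- Agda's standard library has no real numbers.  We therefore abstract over
-- the positive reals ℝ⁺: any carrier with addition and multiplication obeying
-- the algebraic laws that (ℝ⁺, +, ·, 1) satisfies (with propositional equality).
-- The actual ℝ⁺ is an instance, so the theorem below implies the paper's one.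
record PosReals : Set₁ where
  field
    Carrier : Set
    _+_     : Carrier → Carrier → Carrier
    _*_     : Carrier → Carrier → Carrier
    one     : Carrier
    +-isCommutativeSemigroup : IsCommutativeSemigroup _≡_ _+_
    *-isCommutativeMonoid    : IsCommutativeMonoid _≡_ _*_ one
    distrib                  : _DistributesOver_ _≡_ _*_ _+_

module PARSTheory (R : PosReals) where
  open PosReals R

  Dist : Set → Set
  Dist A = List (Carrier × A)

  -- weight of a list (only meaningful for non-empty lists; the empty list
  -- never has weight 1, and Dist₁ only concerns weight-1 lists)
  data HasWeight {A : Set} : Dist A → Carrier → Set where
    single : ∀ p a → HasWeight ((p , a) ∷ []) p
    cons   : ∀ p a {ds w} → HasWeight ds w → HasWeight ((p , a) ∷ ds) (p + w)

  scale : {A : Set} → Carrier → Dist A → Dist A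
  scale α = map (λ pa → (α * proj₁ pa , proj₂ pa))

  record PARS (A : Set) : Set₁ where
    field
      _↦_    : A → Dist A → Set
      ↦-Dist₁ : ∀ {a E} → a ↦ E → HasWeight E one

  module _ {A : Set} (P : PARS A) where
    open PARS P

    data Tree (a : A) : Set where
      leaf : Tree a
      node : (E : Dist A) → a ↦ E → All (λ pa → Tree (proj₂ pa)) E → Tree a

    mutual
      supp : ∀ {a} → Tree a → Dist A
      supp {a} leaf  = (one , a) ∷ []
      supp (node E _ ts) = suppAll ts

      suppAll : ∀ {E : Dist A} → All (λ pa → Tree (proj₂ pa)) E → Dist A
      suppAll [] = []
      suppAll {(p , _) ∷ _} (t ∷ ts) = scale p (supp t) ++ suppAll ts

    data _→P_ : Dist A → Dist A → Set where
      nil  : [] →P []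
      keep : ∀ {p a ds ds'} → ds →P ds' → ((p , a) ∷ ds) →P ((p , a) ∷ ds')
      step : ∀ {p a E ds ds'} → a ↦ E → ds →P ds' → ((p , a) ∷ ds) →P (scale p E ++ ds')

    _→P*_ : Dist A → Dist A → Set
    _→P*_ = Star _→P_

module Submission where

-- Parallel evolution is a congruence for scaling and for concatenation, and it
-- may leave any list unchanged.  Hence a computation tree can be unfolded one
-- node at a time: the root step rewrites [(1,a)] to the distribution E of the
-- root, and the subtrees are then evolved independently, each inside its own
-- scaled block of E, until their supports are reached.

open import Defs
open import Data.List using ([]; _∷_; _++_)
open import Data.List.Properties using (++-assoc; ++-identityʳ; map-++)
open import Data.List.Relation.Unary.All using (All; []; _∷_)
open import Data.Product using (_,_; proj₂)
open import Function using (_∘_)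
open import Relation.Binary.PropositionalEquality using (_≡_; refl; sym; trans; cong; cong₂; subst)
open import Relation.Binary.Construct.Closure.ReflexiveTransitive using (ε; _◅_; _◅◅_; gmap)
open import Algebra.Structures using (IsCommutativeMonoid)

module _ (R : PosReals) where
  open PosReals R
  open PARSTheory R hiding (_→P_; _→P*_)
  open IsCommutativeMonoid *-isCommutativeMonoid using (identityˡ; identityʳ; assoc)

  scale-one : ∀ {A} (ds : Dist A) → scale one ds ≡ ds
  scale-one []             = refl
  scale-one ((q , b) ∷ ds) = cong₂ _∷_ (cong (_, b) (identityˡ q)) (scale-one ds)

  scale-scale : ∀ {A} α p (ds : Dist A) → scale α (scale p ds) ≡ scale (α * p) ds
  scale-scale α p []             = refl
  scale-scale α p ((q , b) ∷ ds) =
    cong₂ _∷_ (cong (_, b) (sym (assoc α p q))) (scale-scale α p ds)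

  scale-unit : ∀ {A} p (a : A) → scale p ((one , a) ∷ []) ≡ (p , a) ∷ []
  scale-unit p a = cong (λ q → (q , a) ∷ []) (identityʳ p)

  module _ {A : Set} (P : PARS A) where
    open PARS P

    _→P_ : Dist A → Dist A → Set
    _→P_ = PARSTheory._→P_ R P

    _→P*_ : Dist A → Dist A → Set
    _→P*_ = PARSTheory._→P*_ R P

    →P-refl : ∀ ds → ds →P ds
    →P-refl []       = nil
    →P-refl (_ ∷ ds) = keep (→P-refl ds)

    ↦⇒→P : ∀ {a E} → a ↦ E → ((one , a) ∷ []) →P E
    ↦⇒→P {E = E} a↦E =
      subst (_ →P_) (trans (++-identityʳ (scale one E)) (scale-one E)) (step a↦E nil)

    →P-scale : ∀ α {ds ds'} → ds →P ds' → scale α ds →P scale α ds'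
    →P-scale α nil      = nil
    →P-scale α (keep r) = keep (→P-scale α r)
    →P-scale α (step {p} {E = E} {ds' = ds'} a↦E r) =
      subst (_ →P_) scaled-step (step a↦E (→P-scale α r))
      where
      scaled-step : scale (α * p) E ++ scale α ds' ≡ scale α (scale p E ++ ds')
      scaled-step = trans (cong (_++ scale α ds') (sym (scale-scale α p E)))
                          (sym (map-++ _ (scale p E) ds'))

    →P-++ : ∀ {ds ds' es es'} → ds →P ds' → es →P es' → (ds ++ es) →P (ds' ++ es')
    →P-++ nil      s = s
    →P-++ (keep r) s = keep (→P-++ r s)
    →P-++ (step {p} {E = E} {ds' = ds'} a↦E r) s =
      subst (_ →P_) (sym (++-assoc (scale p E) ds' _)) (step a↦E (→P-++ r s))

    →P*-scale : ∀ α {ds ds'} → ds →P* ds' → scale α ds →P* scale α ds'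
    →P*-scale α = gmap (scale α) (→P-scale α)

    →P*-++ : ∀ {ds ds' es es'} → ds →P* ds' → es →P* es' → (ds ++ es) →P* (ds' ++ es')
    →P*-++ {ds' = ds'} {es = es} r s =
      gmap (_++ es) (λ x → →P-++ x (→P-refl es)) r
      ◅◅ gmap (ds' ++_) (→P-++ (→P-refl ds')) s

    mutual
      unit→P*supp : ∀ {a} (T : Tree P a) → ((one , a) ∷ []) →P* supp P T
      unit→P*supp leaf            = ε
      unit→P*supp (node E a↦E ts) = ↦⇒→P a↦E ◅ →P*-suppAll ts

      →P*-suppAll : ∀ {E} (ts : All (Tree P ∘ proj₂) E) → E →P* suppAll P ts
      →P*-suppAll []                     = ε
      →P*-suppAll {(p , b) ∷ E} (t ∷ ts) =
        subst (_→P* (scale p (supp P t) ++ suppAll P ts)) (cong (_++ E) (scale-unit p b))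
          (→P*-++ (→P*-scale p (unit→P*supp t)) (→P*-suppAll ts))

lemma3p3 : (R : PosReals) {A : Set} (P : PARSTheory.PARS R A) (a : A)
           (T : PARSTheory.Tree R P a) →
           PARSTheory._→P*_ R P ((PosReals.one R , a) ∷ []) (PARSTheory.supp R P T)
lemma3p3 R P a = unit→P*supp R P
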